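{- Let $q$ be an odd prime power and $n \geq 1$. Let $\beta$ be a proper element of $\mathbb{F}_{q^{2n}}$. Then $\beta^2 \in \mathbb{F}_{q^n}$ if and only if the minimal polynomial $B(X)$ of $\beta$ over $\mathbb{F}_q$ satisfies $B(X) = A(X^2)$ for some $A(X) \in \mathbb{F}_q[X]$. Moreover, in such a case $A(X)$ is the minimal polynomial of $\beta^2$ over $\mathbb{F}_q$.
   Context: An element of $\mathbb{F}_{q^m}$ is called proper if it belongs to $\mathbb{F}_{q^m}$ but does not belong to any subfield $\mathbb{F}_{q^s} \neq \mathbb{F}_{q^m}$ of it. -}

module Defs where

open import Level using (Level; _⊔_)
open import Data.Nat as ℕ using (ℕ; zero; suc; _≤_; _<_)
open import Data.Nat.Divisibility using (_∣_)
open import Data.Nat.Primality using (Prime)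
open import Data.Fin using (Fin)
open import Data.List using (List; []; _∷_)
open import Data.Product using (Σ; ∃; ∃-syntax; _×_; _,_)
open import Relation.Nullary using (¬_)
open import Relation.Binary.PropositionalEquality as ≡ using (_≡_)
open import Function.Bundles using (Bijection)
open import Algebra.Bundles using (CommutativeRing)

OddPrimePower : ℕ → Set
OddPrimePower q = ∃[ p ] ∃[ k ] (Prime p × ¬ (p ≡ 2) × 1 ≤ k × q ≡ p ℕ.^ k)

module FF {c ℓ : Level} (R : CommutativeRing c ℓ) where
  open CommutativeRing R public

  _^_ : Carrier → ℕ → Carrier
  x ^ zero  = 1#
  x ^ suc k = x * (x ^ k)

  IsField : Set (c ⊔ ℓ)
  IsField = (¬ (1# ≈ 0#)) × (∀ x → ¬ (x ≈ 0#) → ∃[ y ] (x * y ≈ 1#))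

  HasCard : ℕ → Set (c ⊔ ℓ)
  HasCard N = Bijection (≡.setoid (Fin N)) setoid

  -- membership in the subfield F_{Q} = { x | x ^ Q = x } (Q a power of q)
  InSub : ℕ → Carrier → Set ℓ
  InSub Q x = x ^ Q ≈ x

  -- Polynomials: coefficient lists, lowest degree first
  Poly : Set c
  Poly = List Carrier

  coeff : Poly → ℕ → Carrier
  coeff []       _       = 0#
  coeff (a ∷ _)  zero    = a
  coeff (_ ∷ as) (suc i) = coeff as i

  eval : Poly → Carrier → Carrier
  eval []       x = 0#
  eval (a ∷ as) x = a + x * eval as x

  -- A(X) ↦ A(X²)
  sqArg : Poly → Poly
  sqArg []       = []
  sqArg (a ∷ as) = a ∷ 0# ∷ sqArg as

  -- equality of polynomials (coefficientwise, ignoring trailing zeros)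
  _≈ₚ_ : Poly → Poly → Set ℓ
  P ≈ₚ Q = ∀ i → coeff P i ≈ coeff Q i

  Over : ℕ → Poly → Set ℓ
  Over q P = ∀ i → InSub q (coeff P i)

  MonicDeg : Poly → ℕ → Set ℓ
  MonicDeg P d = (coeff P d ≈ 1#) × (∀ i → d < i → coeff P i ≈ 0#)

  IsMinPoly : ℕ → Poly → Carrier → Set (c ⊔ ℓ)
  IsMinPoly q P β =
    Over q P × (∃[ d ] (MonicDeg P d × eval P β ≈ 0# ×
      (∀ Q e → Over q Q → MonicDeg Q e → eval Q β ≈ 0# → d ≤ e)))

  Proper : ℕ → ℕ → Carrier → Set ℓ
  Proper q m β = InSub (q ℕ.^ m) β ×
    (∀ s → s ∣ m → s < m → ¬ InSub (q ℕ.^ s) β)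

-- Let φ(x) = x^q be the Frobenius map of F = F_{q²ⁿ}; it is an
-- injective ring endomorphism fixing F_q, so φᵃβ is a root of B for every a.
-- As β is proper, φˢβ = β exactly when 2n ∣ s; hence φ⁰β, …, φ²ⁿ⁻¹β are
-- distinct, deg B ≤ 2n (via ∏ (X − φⁱβ) ∈ F_q[X]), and by the root bound every
-- root of B is one of them.  Now
--   β² ∈ F_{qⁿ}  ⇔  φⁿβ = −β     (φⁿβ is a square root of β², and φⁿβ ≠ β),
--   φⁿβ = −β     ⇔  B(−β) = 0    (⇐: −β = φᵃβ forces 2n ∣ 2a, so a = n),
--   B(−β) = 0    ⇔  B is even    (⇒: writing B = E(X²) + X·O(X²), 2 ≠ 0 gives
--                                  O(β²) = 0, and O(X²) has degree < deg B).
-- Finally if B = A(X²), then A is monic over F_q with root β², and any such Q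
-- yields Q(X²) with root β, so deg A ≤ deg Q.
module Submission where

open import Defs
open import Level using (Level)
open import Data.Nat as ℕ using (ℕ; zero; suc; z≤n; s≤s; _!)
import Data.Nat.Properties as ℕP
open import Data.Nat.Properties using (_!*_!≢0)
open import Data.Nat.Divisibility using (_∣_; divides; ∣⇒≤; ∣1⇒≡1; m∣m*n; *-cancelˡ-∣)
open import Data.Nat.Primality using (Prime; euclidsLemma; prime⇒nonZero; prime⇒nonTrivial; prime⇒irreducible)
open import Data.Nat.Combinatorics using (_C_; nCn≡1; nCk≡n!/k![n-k]!; k![n∸k]!∣n!)
open import Data.Nat.DivMod using (m/n*n≡m)
open import Data.Nat.GCD using (gcd; gcd-GCD; module Bézout; gcd[m,n]∣m; gcd[m,n]∣n)
open import Data.Fin as Fin using (Fin; toℕ; inject₁; fromℕ) renaming (zero to fzero; suc to fsuc)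
import Data.Fin.Properties as FinP
open import Data.List using (List; []; _∷_; _∷ʳ_; map; length; drop; applyUpTo)
open import Data.List.Properties using (map-applyUpTo; applyUpTo-∷ʳ; length-applyUpTo)
open import Data.List.Relation.Binary.Pointwise as Pointwise using (Pointwise; []; _∷_)
open import Data.Product using (∃; ∃-syntax; _×_; _,_; proj₁; proj₂)
open import Data.Sum using (_⊎_; inj₁; inj₂)
open import Data.Empty using (⊥; ⊥-elim)
open import Function using (_∘_; _⇔_; mk⇔)
open import Function.Bundles using (Bijection; _↔_; mk↔ₛ′)
open import Relation.Nullary using (¬_; Dec; yes; no)
open import Relation.Binary.Definitions using (tri<; tri≈; tri>)
open import Relation.Binary.PropositionalEquality as ≡ using (_≡_)
open import Algebra.Bundles using (CommutativeRing)

prime>1 : ∀ {p} → Prime p → 1 ℕ.< p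
prime>1 {p} pr = ℕ.nonTrivial⇒n>1 p {{prime⇒nonTrivial pr}}

prime∤factorial : ∀ {p} → Prime p → ∀ m → m ℕ.< p → ¬ (p ∣ m !)
prime∤factorial pr zero _ p∣1 = ℕP.<⇒≢ (prime>1 pr) (≡.sym (∣1⇒≡1 p∣1))
prime∤factorial pr (suc m) m<p p∣m! with euclidsLemma (suc m) (m !) pr p∣m!
... | inj₁ p∣1+m = ℕP.<⇒≱ m<p (∣⇒≤ p∣1+m)
... | inj₂ p∣m!  = prime∤factorial pr m (ℕP.<-trans (ℕP.n<1+n m) m<p) p∣m!

-- For 0 < k < p the prime p divides p C k: it divides
-- p! = (p C k) · k! · (p ∸ k)! but neither k! nor (p ∸ k)!.
prime∣binomial : ∀ {p} → Prime p → ∀ k → 0 ℕ.< k → k ℕ.< p → p ∣ p C k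
prime∣binomial {p@(suc p′)} pr k 0<k k<p with euclidsLemma (p C k) (k ! ℕ.* (p ℕ.∸ k) !) pr p∣product
  where
    instance _ = k !* (p ℕ.∸ k) !≢0
    p!-split : (p C k) ℕ.* (k ! ℕ.* (p ℕ.∸ k) !) ≡ p !
    p!-split = ≡.trans (≡.cong (ℕ._* (k ! ℕ.* (p ℕ.∸ k) !)) (nCk≡n!/k![n-k]! (ℕP.<⇒≤ k<p)))
                       (m/n*n≡m (k![n∸k]!∣n! (ℕP.<⇒≤ k<p)))
    p∣product : p ∣ (p C k) ℕ.* (k ! ℕ.* (p ℕ.∸ k) !)
    p∣product = ≡.subst (p ∣_) (≡.sym p!-split) (m∣m*n (p′ !))
... | inj₁ p∣C = p∣C
... | inj₂ p∣k![p∸k]! with euclidsLemma (k !) ((p ℕ.∸ k) !) pr p∣k![p∸k]!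
...   | inj₁ p∣k! = ⊥-elim (prime∤factorial pr k k<p p∣k!)
...   | inj₂ p∣[p∸k]! = ⊥-elim (prime∤factorial pr (p ℕ.∸ k) (ℕP.∸-monoʳ-< 0<k (ℕP.<⇒≤ k<p)) p∣[p∸k]!)

-- Doubling, by the recursion that matches the interleaving of coefficients in sqArg.
double : ℕ → ℕ
double zero    = zero
double (suc i) = suc (suc (double i))

double≡2* : ∀ i → double i ≡ 2 ℕ.* i
double≡2* zero    = ≡.refl
double≡2* (suc i) = ≡.cong suc (≡.trans (≡.cong suc (double≡2* i)) (≡.sym (ℕP.+-suc i (i ℕ.+ 0))))

double-<-mono : ∀ {i j} → i ℕ.< j → double i ℕ.< double j
double-<-mono {zero}  {suc j} _         = s≤s z≤n
double-<-mono {suc i} {suc j} (s≤s i<j) = s≤s (s≤s (double-<-mono i<j))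

double-≤-cancel : ∀ {i j} → double i ℕ.≤ double j → i ℕ.≤ j
double-≤-cancel {zero}              _                 = z≤n
double-≤-cancel {suc i} {suc j} (s≤s (s≤s h)) = s≤s (double-≤-cancel h)

double-<-cancel : ∀ {i j} → double i ℕ.< double j → i ℕ.< j
double-<-cancel {zero}  {suc j} _                 = s≤s z≤n
double-<-cancel {suc i} {suc j} (s≤s (s≤s h)) = s≤s (double-<-cancel h)

data Parity : ℕ → Set where
  even : ∀ i → Parity (double i)
  odd  : ∀ i → Parity (suc (double i))

parity : ∀ j → Parity j
parity zero = even 0
parity (suc j) with parity j
... | even i = odd i
... | odd i  = even (suc i)

odd-prime : ∀ {p} → Prime p → ¬ (p ≡ 2) → ∃ λ i → p ≡ suc (double i)
odd-prime {p} pr p≢2 with parity p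
... | odd i  = i , ≡.refl
... | even i with prime⇒irreducible pr (divides i (≡.trans (double≡2* i) (ℕP.*-comm 2 i)))
...   | inj₁ ()
...   | inj₂ 2≡p = ⊥-elim (p≢2 (≡.sym 2≡p))

half-of-period : ∀ {n a} → 0 ℕ.< a → a ℕ.< 2 ℕ.* n → 2 ℕ.* n ∣ 2 ℕ.* a → a ≡ n
half-of-period {n} {a} 0<a a<2n 2n∣2a with *-cancelˡ-∣ 2 2n∣2a
... | divides zero          a≡0  = ⊥-elim (ℕP.<⇒≢ 0<a (≡.sym a≡0))
... | divides (suc zero)    a≡n  = ≡.trans a≡n (ℕP.+-identityʳ n)
... | divides (suc (suc k)) a≡kn = ⊥-elim (ℕP.<⇒≱ a<2n 2n≤a)
  where
    2n≤a : 2 ℕ.* n ℕ.≤ a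
    2n≤a = ≡.subst (2 ℕ.* n ℕ.≤_) (≡.sym a≡kn) (ℕP.+-monoʳ-≤ n (ℕP.+-monoʳ-≤ n z≤n))

module Polynomials {c ℓ} (R : CommutativeRing c ℓ) where
  open FF R hiding (zero) public
  open import Relation.Binary.Reasoning.Setoid setoid public
  open import Algebra.Properties.Ring ring public
    using (-‿distribˡ-*; -‿distribʳ-*; -‿involutive; +-inverseˡ-unique; x∙y⁻¹≈ε⇒x≈y; x≈y⇒x∙y⁻¹≈ε)
  import Algebra.Properties.CommutativeSemiring.Exp commutativeSemiring as Exp
  open import Algebra.Solver.Ring.NaturalCoefficients.Default commutativeSemiring

  -- The power operation of Defs agrees with the library's, whose laws we reuse.
  ^≈^ₗ : ∀ x n → x ^ n ≈ x Exp.^ n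
  ^≈^ₗ x zero    = refl
  ^≈^ₗ x (suc n) = *-congˡ (^≈^ₗ x n)

  ^-congˡ : ∀ n {x y} → x ≈ y → x ^ n ≈ y ^ n
  ^-congˡ n {x} {y} x≈y = trans (^≈^ₗ x n) (trans (Exp.^-congˡ n x≈y) (sym (^≈^ₗ y n)))

  ^-distrib-* : ∀ x y n → (x * y) ^ n ≈ x ^ n * y ^ n
  ^-distrib-* x y n = begin
    (x * y) ^ n          ≈⟨ ^≈^ₗ (x * y) n ⟩
    (x * y) Exp.^ n      ≈⟨ Exp.^-distrib-* x y n ⟩
    x Exp.^ n * y Exp.^ n ≈⟨ sym (*-cong (^≈^ₗ x n) (^≈^ₗ y n)) ⟩
    x ^ n * y ^ n        ∎

  ^-*-assoc : ∀ x m n → x ^ (m ℕ.* n) ≈ (x ^ m) ^ n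
  ^-*-assoc x m n = begin
    x ^ (m ℕ.* n)         ≈⟨ ^≈^ₗ x (m ℕ.* n) ⟩
    x Exp.^ (m ℕ.* n)     ≈⟨ sym (Exp.^-assocʳ x m n) ⟩
    (x Exp.^ m) Exp.^ n   ≈⟨ Exp.^-congˡ n (sym (^≈^ₗ x m)) ⟩
    (x ^ m) Exp.^ n       ≈⟨ sym (^≈^ₗ (x ^ m) n) ⟩
    (x ^ m) ^ n           ∎

  1^n≈1 : ∀ n → 1# ^ n ≈ 1#
  1^n≈1 zero    = refl
  1^n≈1 (suc n) = trans (*-identityˡ _) (1^n≈1 n)

  0^n≈0 : ∀ {n} → 0 ℕ.< n → 0# ^ n ≈ 0#
  0^n≈0 {suc n} _ = zeroˡ _

  -neg-squared : ∀ x → - x * - x ≈ x * x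
  -neg-squared x = trans (sym (-‿distribˡ-* x (- x))) (trans (-‿cong (sym (-‿distribʳ-* x x))) (-‿involutive _))

  difference-of-squares : ∀ x y → (x + - y) * (x + y) ≈ x * x + - (y * y)
  difference-of-squares x y = begin
    (x + - y) * (x + y)                          ≈⟨ distribʳ (x + y) x (- y) ⟩
    x * (x + y) + - y * (x + y)                  ≈⟨ +-congˡ (sym (-‿distribˡ-* y (x + y))) ⟩
    x * (x + y) + - (y * (x + y))                ≈⟨ +-cong (distribˡ x x y) (-‿cong (distribˡ y x y)) ⟩
    (x * x + x * y) + - (y * x + y * y)          ≈⟨ +-congˡ (-‿cong (+-congʳ (*-comm y x))) ⟩
    (x * x + x * y) + - (x * y + y * y)          ≈⟨ +-assoc (x * x) (x * y) _ ⟩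
    x * x + (x * y + - (x * y + y * y))          ≈⟨ +-congˡ (+-inverseˡ-unique _ _ (cancel (x * y) (y * y))) ⟩
    x * x + - (y * y)                            ∎
    where
      cancel : ∀ a b → (a + - (a + b)) + b ≈ 0#
      cancel a b = begin
        (a + - (a + b)) + b ≈⟨ +-congʳ (+-comm a _) ⟩
        (- (a + b) + a) + b ≈⟨ +-assoc _ a b ⟩
        - (a + b) + (a + b) ≈⟨ -‿inverseˡ (a + b) ⟩
        0#                  ∎

  eval-congʳ : ∀ P {x y} → x ≈ y → eval P x ≈ eval P y
  eval-congʳ []      x≈y = refl
  eval-congʳ (a ∷ P) x≈y = +-congˡ (*-cong x≈y (eval-congʳ P x≈y))

  eval-of-zero : ∀ P x → (∀ i → coeff P i ≈ 0#) → eval P x ≈ 0#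
  eval-of-zero []      x P≈0 = refl
  eval-of-zero (a ∷ P) x P≈0 = begin
    a + x * eval P x ≈⟨ +-cong (P≈0 0) (*-congˡ (eval-of-zero P x (P≈0 ∘ suc))) ⟩
    0# + x * 0#      ≈⟨ +-identityˡ _ ⟩
    x * 0#           ≈⟨ zeroʳ x ⟩
    0#               ∎

  eval-congˡ : ∀ P Q x → P ≈ₚ Q → eval P x ≈ eval Q x
  eval-congˡ []      []      x P≈Q = refl
  eval-congˡ []      (b ∷ Q) x P≈Q = sym (eval-of-zero (b ∷ Q) x (sym ∘ P≈Q))
  eval-congˡ (a ∷ P) []      x P≈Q = eval-of-zero (a ∷ P) x P≈Q
  eval-congˡ (a ∷ P) (b ∷ Q) x P≈Q = +-cong (P≈Q 0) (*-congˡ (eval-congˡ P Q x (P≈Q ∘ suc)))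

  coeff-sqArg-even : ∀ A i → coeff (sqArg A) (double i) ≡ coeff A i
  coeff-sqArg-even []      i       = ≡.refl
  coeff-sqArg-even (a ∷ A) zero    = ≡.refl
  coeff-sqArg-even (a ∷ A) (suc i) = coeff-sqArg-even A i

  coeff-sqArg-odd : ∀ A i → coeff (sqArg A) (suc (double i)) ≡ 0#
  coeff-sqArg-odd []      i       = ≡.refl
  coeff-sqArg-odd (a ∷ A) zero    = ≡.refl
  coeff-sqArg-odd (a ∷ A) (suc i) = coeff-sqArg-odd A i

  eval-sqArg : ∀ A x → eval (sqArg A) x ≈ eval A (x * x)
  eval-sqArg []      x = refl
  eval-sqArg (a ∷ A) x = begin
    a + x * (0# + x * eval (sqArg A) x) ≈⟨ interleave a x (eval (sqArg A) x) ⟩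
    a + (x * x) * eval (sqArg A) x       ≈⟨ +-congˡ (*-congˡ (eval-sqArg A x)) ⟩
    a + (x * x) * eval A (x * x)         ∎
    where
      interleave : ∀ a x e → a + x * (0# + x * e) ≈ a + (x * x) * e
      interleave = solve 3 (λ a x e → a :+ x :* (con 0 :+ x :* e) := a :+ (x :* x) :* e) refl

  eval-sqArg-neg : ∀ A x → eval (sqArg A) (- x) ≈ eval (sqArg A) x
  eval-sqArg-neg A x = begin
    eval (sqArg A) (- x) ≈⟨ eval-sqArg A (- x) ⟩
    eval A (- x * - x)   ≈⟨ eval-congʳ A (-neg-squared x) ⟩
    eval A (x * x)       ≈⟨ sym (eval-sqArg A x) ⟩
    eval (sqArg A) x     ∎

  sqArg-monic : ∀ A e → MonicDeg A e → MonicDeg (sqArg A) (double e)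
  sqArg-monic A e (lead , above) = ≡.subst (_≈ 1#) (≡.sym (coeff-sqArg-even A e)) lead , above′
    where
      above′ : ∀ j → double e ℕ.< j → coeff (sqArg A) j ≈ 0#
      above′ j 2e<j with parity j
      ... | even i = ≡.subst (_≈ 0#) (≡.sym (coeff-sqArg-even A i)) (above i (double-<-cancel 2e<j))
      ... | odd i  = reflexive (coeff-sqArg-odd A i)

  ≈ₚ-sqArg : ∀ P A → (∀ i → coeff P (double i) ≈ coeff A i) → (∀ i → coeff P (suc (double i)) ≈ 0#) → P ≈ₚ sqArg A
  ≈ₚ-sqArg P A evens≈ odds≈0 j with parity j
  ... | even i = trans (evens≈ i) (reflexive (≡.sym (coeff-sqArg-even A i)))
  ... | odd i  = trans (odds≈0 i) (reflexive (≡.sym (coeff-sqArg-odd A i)))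

  evens odds : Poly → Poly
  evens []          = []
  evens (a ∷ [])    = a ∷ []
  evens (a ∷ b ∷ P) = a ∷ evens P
  odds []          = []
  odds (a ∷ [])    = []
  odds (a ∷ b ∷ P) = b ∷ odds P

  coeff-evens : ∀ P i → coeff (evens P) i ≡ coeff P (double i)
  coeff-evens []          i       = ≡.refl
  coeff-evens (a ∷ [])    zero    = ≡.refl
  coeff-evens (a ∷ [])    (suc i) = ≡.refl
  coeff-evens (a ∷ b ∷ P) zero    = ≡.refl
  coeff-evens (a ∷ b ∷ P) (suc i) = coeff-evens P i

  coeff-odds : ∀ P i → coeff (odds P) i ≡ coeff P (suc (double i))
  coeff-odds []          i       = ≡.refl
  coeff-odds (a ∷ [])    i       = ≡.refl
  coeff-odds (a ∷ b ∷ P) zero    = ≡.refl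
  coeff-odds (a ∷ b ∷ P) (suc i) = coeff-odds P i

  eval-even-odd : ∀ P x → eval P x ≈ eval (evens P) (x * x) + x * eval (odds P) (x * x)
  eval-even-odd []          x = sym (trans (+-identityˡ _) (zeroʳ x))
  eval-even-odd (a ∷ [])    x = begin
    a + x * 0#                      ≈⟨ +-congˡ (zeroʳ x) ⟩
    a + 0#                          ≈⟨ sym (trans (+-cong (+-congˡ (zeroʳ (x * x))) (zeroʳ x)) (+-identityʳ (a + 0#))) ⟩
    (a + (x * x) * 0#) + x * 0#     ∎
  eval-even-odd (a ∷ b ∷ P) x = begin
    a + x * (b + x * eval P x)       ≈⟨ +-congˡ (*-congˡ (+-congˡ (*-congˡ (eval-even-odd P x)))) ⟩
    a + x * (b + x * (E + x * O))    ≈⟨ regroup a b x E O ⟩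
    (a + (x * x) * E) + x * (b + (x * x) * O) ∎
    where
      E O : Carrier
      E = eval (evens P) (x * x)
      O = eval (odds P) (x * x)
      regroup : ∀ a b x e o → a + x * (b + x * (e + x * o)) ≈ (a + (x * x) * e) + x * (b + (x * x) * o)
      regroup = solve 5 (λ a b x e o → a :+ x :* (b :+ x :* (e :+ x :* o)) := (a :+ (x :* x) :* e) :+ x :* (b :+ (x :* x) :* o)) refl

  scale : Carrier → Poly → Poly
  scale y = map (y *_)

  coeff-scale : ∀ y P i → coeff (scale y P) i ≈ y * coeff P i
  coeff-scale y []      i       = sym (zeroʳ y)
  coeff-scale y (a ∷ P) zero    = refl
  coeff-scale y (a ∷ P) (suc i) = coeff-scale y P i

  eval-scale : ∀ y P x → eval (scale y P) x ≈ y * eval P x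
  eval-scale y []      x = sym (zeroʳ y)
  eval-scale y (a ∷ P) x = begin
    y * a + x * eval (scale y P) x ≈⟨ +-congˡ (*-congˡ (eval-scale y P x)) ⟩
    y * a + x * (y * eval P x)     ≈⟨ factor y a x (eval P x) ⟩
    y * (a + x * eval P x)         ∎
    where
      factor : ∀ y a x e → y * a + x * (y * e) ≈ y * (a + x * e)
      factor = solve 4 (λ y a x e → y :* a :+ x :* (y :* e) := y :* (a :+ x :* e)) refl

  _⊕_ : Poly → Poly → Poly
  []      ⊕ Q       = Q
  (a ∷ P) ⊕ []      = a ∷ P
  (a ∷ P) ⊕ (b ∷ Q) = (a + b) ∷ (P ⊕ Q)

  coeff-⊕ : ∀ P Q i → coeff (P ⊕ Q) i ≈ coeff P i + coeff Q i
  coeff-⊕ []      Q       i       = sym (+-identityˡ _)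
  coeff-⊕ (a ∷ P) []      i       = sym (+-identityʳ _)
  coeff-⊕ (a ∷ P) (b ∷ Q) zero    = refl
  coeff-⊕ (a ∷ P) (b ∷ Q) (suc i) = coeff-⊕ P Q i

  eval-⊕ : ∀ P Q x → eval (P ⊕ Q) x ≈ eval P x + eval Q x
  eval-⊕ []      Q       x = sym (+-identityˡ _)
  eval-⊕ (a ∷ P) []      x = sym (+-identityʳ _)
  eval-⊕ (a ∷ P) (b ∷ Q) x = begin
    (a + b) + x * eval (P ⊕ Q) x              ≈⟨ +-congˡ (*-congˡ (eval-⊕ P Q x)) ⟩
    (a + b) + x * (eval P x + eval Q x)       ≈⟨ regroup a b x (eval P x) (eval Q x) ⟩
    (a + x * eval P x) + (b + x * eval Q x)   ∎
    where
      regroup : ∀ a b x e f → (a + b) + x * (e + f) ≈ (a + x * e) + (b + x * f)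
      regroup = solve 5 (λ a b x e f → (a :+ b) :+ x :* (e :+ f) := (a :+ x :* e) :+ (b :+ x :* f)) refl

  linFactor : Carrier → Poly → Poly
  linFactor r P = (0# ∷ P) ⊕ scale (- r) P

  eval-linFactor : ∀ r P x → eval (linFactor r P) x ≈ (x + - r) * eval P x
  eval-linFactor r P x = begin
    eval (linFactor r P) x                   ≈⟨ eval-⊕ (0# ∷ P) (scale (- r) P) x ⟩
    (0# + x * eval P x) + eval (scale (- r) P) x ≈⟨ +-cong (+-identityˡ _) (eval-scale (- r) P x) ⟩
    x * eval P x + - r * eval P x            ≈⟨ sym (distribʳ (eval P x) x (- r)) ⟩
    (x + - r) * eval P x                     ∎

  shiftCoeff : (ℕ → Carrier) → ℕ → Carrier
  shiftCoeff f zero    = 0#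
  shiftCoeff f (suc i) = f i

  linCoeff : Carrier → (ℕ → Carrier) → ℕ → Carrier
  linCoeff r f i = shiftCoeff f i + - r * f i

  coeff-linFactor : ∀ r P i → coeff (linFactor r P) i ≈ linCoeff r (coeff P) i
  coeff-linFactor r P i = trans (coeff-⊕ (0# ∷ P) (scale (- r) P) i) (+-cong (shift i) (coeff-scale (- r) P i))
    where
      shift : ∀ i → coeff (0# ∷ P) i ≈ shiftCoeff (coeff P) i
      shift zero    = refl
      shift (suc i) = refl

  linCoeff-cong : ∀ {r s} f g → r ≈ s → (∀ j → f j ≈ g j) → ∀ i → linCoeff r f i ≈ linCoeff s g i
  linCoeff-cong f g r≈s f≈g zero    = +-congˡ (*-cong (-‿cong r≈s) (f≈g 0))
  linCoeff-cong f g r≈s f≈g (suc i) = +-cong (f≈g i) (*-cong (-‿cong r≈s) (f≈g (suc i)))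

  linCoeff-comm : ∀ r s f i → linCoeff r (linCoeff s f) i ≈ linCoeff s (linCoeff r f) i
  linCoeff-comm r s f zero    = swap₀ (- r) (- s) (f 0)
    where
      swap₀ : ∀ r s a → 0# + r * (0# + s * a) ≈ 0# + s * (0# + r * a)
      swap₀ = solve 3 (λ r s a → con 0 :+ r :* (con 0 :+ s :* a) := con 0 :+ s :* (con 0 :+ r :* a)) refl
  linCoeff-comm r s f (suc i) = swap (- r) (- s) (shiftCoeff f i) (f i) (f (suc i))
    where
      swap : ∀ r s a b c → (a + s * b) + r * (b + s * c) ≈ (a + r * b) + s * (b + r * c)
      swap = solve 5 (λ r s a b c → (a :+ s :* b) :+ r :* (b :+ s :* c) := (a :+ r :* b) :+ s :* (b :+ r :* c)) refl

  linFactor-cong : ∀ {r s} P Q → r ≈ s → P ≈ₚ Q → linFactor r P ≈ₚ linFactor s Q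
  linFactor-cong P Q r≈s P≈Q i = begin
    coeff (linFactor _ P) i   ≈⟨ coeff-linFactor _ P i ⟩
    linCoeff _ (coeff P) i    ≈⟨ linCoeff-cong (coeff P) (coeff Q) r≈s P≈Q i ⟩
    linCoeff _ (coeff Q) i    ≈⟨ sym (coeff-linFactor _ Q i) ⟩
    coeff (linFactor _ Q) i   ∎

  linFactor-comm : ∀ r s P → linFactor r (linFactor s P) ≈ₚ linFactor s (linFactor r P)
  linFactor-comm r s P i = begin
    coeff (linFactor r (linFactor s P)) i ≈⟨ coeff-linFactor r (linFactor s P) i ⟩
    linCoeff r (coeff (linFactor s P)) i  ≈⟨ linCoeff-cong _ _ refl (coeff-linFactor s P) i ⟩
    linCoeff r (linCoeff s (coeff P)) i   ≈⟨ linCoeff-comm r s (coeff P) i ⟩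
    linCoeff s (linCoeff r (coeff P)) i   ≈⟨ linCoeff-cong _ _ refl (sym ∘ coeff-linFactor r P) i ⟩
    linCoeff s (coeff (linFactor r P)) i  ≈⟨ sym (coeff-linFactor s (linFactor r P) i) ⟩
    coeff (linFactor s (linFactor r P)) i ∎

  linFactor-monic : ∀ r P d → MonicDeg P d → MonicDeg (linFactor r P) (suc d)
  linFactor-monic r P d (lead , above) = lead′ , above′
    where
      absorb : ∀ {a b} j → a ≈ b → coeff P j ≈ 0# → a + - r * coeff P j ≈ b
      absorb j a≈b vanish = trans (+-cong a≈b (trans (*-congˡ vanish) (zeroʳ (- r)))) (+-identityʳ _)
      lead′ : coeff (linFactor r P) (suc d) ≈ 1#
      lead′ = trans (coeff-linFactor r P (suc d)) (absorb (suc d) lead (above (suc d) ℕP.≤-refl))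
      above′ : ∀ i → suc d ℕ.< i → coeff (linFactor r P) i ≈ 0#
      above′ (suc i) (s≤s d<i) = trans (coeff-linFactor r P (suc i))
        (absorb (suc i) (above i d<i) (above (suc i) (ℕP.m<n⇒m<1+n d<i)))

  linProduct : List Carrier → Poly
  linProduct []       = 1# ∷ []
  linProduct (r ∷ rs) = linFactor r (linProduct rs)

  linProduct-monic : ∀ rs → MonicDeg (linProduct rs) (length rs)
  linProduct-monic []       = refl , λ { (suc i) _ → refl }
  linProduct-monic (r ∷ rs) = linFactor-monic r (linProduct rs) (length rs) (linProduct-monic rs)

  linProduct-root : ∀ r rs → eval (linProduct (r ∷ rs)) r ≈ 0#
  linProduct-root r rs = begin
    eval (linFactor r (linProduct rs)) r ≈⟨ eval-linFactor r (linProduct rs) r ⟩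
    (r + - r) * eval (linProduct rs) r   ≈⟨ *-congʳ (-‿inverseʳ r) ⟩
    0# * eval (linProduct rs) r          ≈⟨ zeroˡ _ ⟩
    0#                                   ∎

  linProduct-cong : ∀ {rs ss} → Pointwise _≈_ rs ss → linProduct rs ≈ₚ linProduct ss
  linProduct-cong []                          i = refl
  linProduct-cong {r ∷ rs} {s ∷ ss} (r≈s ∷ rs≈ss) =
    linFactor-cong (linProduct rs) (linProduct ss) r≈s (linProduct-cong rs≈ss)

  linProduct-rotate : ∀ x rs → linProduct (rs ∷ʳ x) ≈ₚ linProduct (x ∷ rs)
  linProduct-rotate x []       i = refl
  linProduct-rotate x (r ∷ rs) i = trans
    (linFactor-cong (linProduct (rs ∷ʳ x)) (linProduct (x ∷ rs)) refl (linProduct-rotate x rs) i)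
    (linFactor-comm r x (linProduct rs) i)

  module Image (φ : Carrier → Carrier)
               (φ-cong : ∀ {x y} → x ≈ y → φ x ≈ φ y)
               (φ-+ : ∀ x y → φ (x + y) ≈ φ x + φ y)
               (φ-* : ∀ x y → φ (x * y) ≈ φ x * φ y)
               (φ-0 : φ 0# ≈ 0#) (φ-1 : φ 1# ≈ 1#) where

    φ-neg : ∀ x → φ (- x) ≈ - φ x
    φ-neg x = +-inverseˡ-unique _ _ (trans (sym (φ-+ (- x) x)) (trans (φ-cong (-‿inverseˡ x)) φ-0))

    linCoeff-φ : ∀ r f i → linCoeff (φ r) (φ ∘ f) i ≈ φ (linCoeff r f i)
    linCoeff-φ r f zero    = sym (trans (φ-+ _ _) (+-cong φ-0 (trans (φ-* _ _) (*-congʳ (φ-neg r)))))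
    linCoeff-φ r f (suc i) = sym (trans (φ-+ _ _) (+-congˡ (trans (φ-* _ _) (*-congʳ (φ-neg r)))))

    coeff-linProduct-map : ∀ rs i → coeff (linProduct (map φ rs)) i ≈ φ (coeff (linProduct rs) i)
    coeff-linProduct-map []       zero    = sym φ-1
    coeff-linProduct-map []       (suc i) = sym φ-0
    coeff-linProduct-map (r ∷ rs) i = begin
      coeff (linFactor (φ r) (linProduct (map φ rs))) i ≈⟨ coeff-linFactor (φ r) (linProduct (map φ rs)) i ⟩
      linCoeff (φ r) (coeff (linProduct (map φ rs))) i  ≈⟨ linCoeff-cong _ _ refl (coeff-linProduct-map rs) i ⟩
      linCoeff (φ r) (φ ∘ coeff (linProduct rs)) i      ≈⟨ linCoeff-φ r (coeff (linProduct rs)) i ⟩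
      φ (linCoeff r (coeff (linProduct rs)) i)          ≈⟨ φ-cong (sym (coeff-linFactor r (linProduct rs) i)) ⟩
      φ (coeff (linFactor r (linProduct rs)) i)         ∎

  divLin : Poly → Carrier → Poly
  divLin []      r = []
  divLin (a ∷ P) r = eval P r ∷ divLin P r

  eval-divLin : ∀ P r x → eval P x ≈ (x + - r) * eval (divLin P r) x + eval P r
  eval-divLin []      r x = sym (trans (+-identityʳ _) (zeroʳ _))
  eval-divLin (a ∷ P) r x = begin
    a + x * eval P x                                  ≈⟨ +-congˡ (*-congˡ (eval-divLin P r x)) ⟩
    a + x * ((x + - r) * w + v)                       ≈⟨ sym (+-identityʳ _) ⟩
    (a + x * ((x + - r) * w + v)) + 0#                ≈⟨ +-congˡ (sym (trans (*-congʳ (-‿inverseʳ r)) (zeroˡ v))) ⟩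
    (a + x * ((x + - r) * w + v)) + (r + - r) * v     ≈⟨ regroup a x r (- r) w v ⟩
    (x + - r) * (v + x * w) + (a + r * v)             ∎
    where
      w v : Carrier
      w = eval (divLin P r) x
      v = eval P r
      regroup : ∀ a x r r′ w v → (a + x * ((x + r′) * w + v)) + (r + r′) * v ≈ (x + r′) * (v + x * w) + (a + r * v)
      regroup = solve 6 (λ a x r r′ w v → (a :+ x :* ((x :+ r′) :* w :+ v)) :+ (r :+ r′) :* v
                                        := (x :+ r′) :* (v :+ x :* w) :+ (a :+ r :* v)) refl

  coeff-divLin : ∀ P r i → coeff (divLin P r) i ≡ eval (drop (suc i) P) r
  coeff-divLin []      r i       = ≡.refl
  coeff-divLin (a ∷ P) r zero    = ≡.refl
  coeff-divLin (a ∷ P) r (suc i) = coeff-divLin P r i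

  coeff-drop : ∀ k P i → coeff (drop k P) i ≡ coeff P (k ℕ.+ i)
  coeff-drop zero    P       i = ≡.refl
  coeff-drop (suc k) []      i = ≡.refl
  coeff-drop (suc k) (a ∷ P) i = coeff-drop k P i

  eval-constant : ∀ L x → (∀ i → coeff L (suc i) ≈ 0#) → eval L x ≈ coeff L 0
  eval-constant []      x _     = refl
  eval-constant (a ∷ L) x above = trans (+-congˡ (trans (*-congˡ (eval-of-zero L x above)) (zeroʳ x))) (+-identityʳ a)

  divLin-monic : ∀ P r d → MonicDeg P (suc d) → MonicDeg (divLin P r) d
  divLin-monic P r d (lead , above) = lead′ , above′
    where
      tail≈ : ∀ k i → coeff (drop k P) i ≈ coeff P (k ℕ.+ i)
      tail≈ k i = reflexive (coeff-drop k P i)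
      lead′ : coeff (divLin P r) d ≈ 1#
      lead′ = begin
        coeff (divLin P r) d           ≡⟨ coeff-divLin P r d ⟩
        eval (drop (suc d) P) r        ≈⟨ eval-constant (drop (suc d) P) r
                                            (λ i → trans (tail≈ (suc d) (suc i)) (above _ (ℕP.m<m+n (suc d) (s≤s z≤n)))) ⟩
        coeff (drop (suc d) P) 0       ≈⟨ tail≈ (suc d) 0 ⟩
        coeff P (suc d ℕ.+ 0)          ≡⟨ ≡.cong (coeff P) (ℕP.+-identityʳ (suc d)) ⟩
        coeff P (suc d)                ≈⟨ lead ⟩
        1#                             ∎
      above′ : ∀ i → d ℕ.< i → coeff (divLin P r) i ≈ 0#
      above′ i d<i = ≡.subst (_≈ 0#) (≡.sym (coeff-divLin P r i))
        (eval-of-zero (drop (suc i) P) r (λ j → trans (tail≈ (suc i) j) (above _ (s≤s (ℕP.≤-trans d<i (ℕP.m≤m+n i j))))))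

module PrimeCharacteristic {c ℓ} (R : CommutativeRing c ℓ) where
  open Polynomials R
  open import Algebra.Properties.Semiring.Mult semiring using (×-congʳ; ×-homo-1; ×-assocˡ; ×-assoc-*)
    renaming (_×_ to _·_)
  open import Algebra.Properties.CommutativeMonoid.Sum +-commutativeMonoid
    using (sum; sum-cong-≋; sum-replicate; sum-replicate-zero; sum-init-last)
  import Algebra.Properties.CommutativeSemiring.Exp commutativeSemiring as Exp
  import Algebra.Properties.CommutativeSemiring.Binomial commutativeSemiring as Binomial

  -- Here n · x is the n-fold sum x + ⋯ + x.
  ×-zeroʳ : ∀ m → m · 0# ≈ 0#
  ×-zeroʳ m = trans (sym (sum-replicate m)) (sum-replicate-zero m)

  ×-multiple-of-p : ∀ {p} → p · 1# ≈ 0# → ∀ m z → (m ℕ.* p) · z ≈ 0#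
  ×-multiple-of-p {p} p×1≈0 m z = begin
    (m ℕ.* p) · z  ≈⟨ sym (×-assocˡ z m p) ⟩
    m · (p · z)    ≈⟨ ×-congʳ m p×z≈0 ⟩
    m · 0#         ≈⟨ ×-zeroʳ m ⟩
    0#             ∎
    where
      p×z≈0 : p · z ≈ 0#
      p×z≈0 = begin
        p · z          ≈⟨ ×-congʳ p (sym (*-identityˡ z)) ⟩
        p · (1# * z)   ≈⟨ sym (×-assoc-* p 1# z) ⟩
        (p · 1#) * z   ≈⟨ *-congʳ p×1≈0 ⟩
        0# * z         ≈⟨ zeroˡ z ⟩
        0#             ∎

  -- (x + y)ᵖ = xᵖ + yᵖ: all binomial coefficients p C k with 0 < k < p vanish.
  frobenius-+ : ∀ {p} → Prime p → p · 1# ≈ 0# → ∀ x y → (x + y) ^ p ≈ x ^ p + y ^ p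
  frobenius-+ {zero}   pr _      x y = ⊥-elim (ℕP.<⇒≱ (prime>1 pr) z≤n)
  frobenius-+ {suc p′} pr p×1≈0 x y = begin
    (x + y) ^ suc p′                                        ≈⟨ ^≈^ₗ (x + y) (suc p′) ⟩
    (x + y) Exp.^ suc p′                                    ≈⟨ Binomial.theorem (suc p′) x y ⟩
    sum term                                                ≈⟨ +-congˡ (sum-init-last (term ∘ fsuc)) ⟩
    term fzero + (sum (term ∘ fsuc ∘ inject₁) + term (fsuc (fromℕ p′))) ≈⟨ +-cong first (+-cong middle last) ⟩
    y ^ suc p′ + (0# + x ^ suc p′)                          ≈⟨ +-congˡ (+-identityˡ _) ⟩
    y ^ suc p′ + x ^ suc p′                                 ≈⟨ +-comm _ _ ⟩
    x ^ suc p′ + y ^ suc p′                                 ∎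
    where
      term : Fin (suc (suc p′)) → Carrier
      term = Binomial.binomialTerm x y (suc p′)
      term≈ : ∀ k m → toℕ k ≡ m → term k ≈ (suc p′ C m) · (x ^ m * y ^ (suc p′ ℕ.∸ m))
      term≈ k m ≡.refl = ×-congʳ (suc p′ C toℕ k) (sym (*-cong (^≈^ₗ x (toℕ k)) (^≈^ₗ y (suc p′ ℕ.∸ toℕ k))))
      first : term fzero ≈ y ^ suc p′
      first = trans (term≈ fzero 0 ≡.refl) (trans (×-homo-1 _) (*-identityˡ _))
      last : term (fsuc (fromℕ p′)) ≈ x ^ suc p′
      last = begin
        term (fsuc (fromℕ p′))                        ≈⟨ term≈ (fsuc (fromℕ p′)) (suc p′) (≡.cong suc (FinP.toℕ-fromℕ p′)) ⟩
        (suc p′ C suc p′) · (x ^ suc p′ * y ^ (p′ ℕ.∸ p′))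
                                                      ≡⟨ ≡.cong₂ (λ k e → k · (x ^ suc p′ * y ^ e)) (nCn≡1 (suc p′)) (ℕP.n∸n≡0 p′) ⟩
        1 · (x ^ suc p′ * 1#)                         ≈⟨ ×-homo-1 _ ⟩
        x ^ suc p′ * 1#                               ≈⟨ *-identityʳ _ ⟩
        x ^ suc p′                                    ∎
      inner-vanishes : ∀ i → term (fsuc (inject₁ i)) ≈ 0#
      inner-vanishes i with prime∣binomial pr (suc (toℕ i)) (s≤s z≤n) (s≤s (FinP.toℕ<n i))
      ... | divides m C≡m*p = begin
        term (fsuc (inject₁ i))                ≈⟨ term≈ (fsuc (inject₁ i)) (suc (toℕ i)) (≡.cong suc (FinP.toℕ-inject₁ i)) ⟩
        (suc p′ C suc (toℕ i)) · z             ≡⟨ ≡.cong (_· z) C≡m*p ⟩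
        (m ℕ.* suc p′) · z                     ≈⟨ ×-multiple-of-p p×1≈0 m z ⟩
        0#                                     ∎
        where
          z : Carrier
          z = x ^ suc (toℕ i) * y ^ (suc p′ ℕ.∸ suc (toℕ i))
      middle : sum (term ∘ fsuc ∘ inject₁) ≈ 0#
      middle = trans (sum-cong-≋ {p′} inner-vanishes) (sum-replicate-zero p′)

  -- In odd characteristic 2 ≠ 0, since 1 = p·1 − ((p−1)/2)·2.
  two≉0 : ∀ {p} → Prime p → ¬ (p ≡ 2) → p · 1# ≈ 0# → ¬ (1# ≈ 0#) → ¬ (1# + 1# ≈ 0#)
  two≉0 {p} p-prime p≢2 p×1≈0 1≉0 2≈0 with odd-prime p-prime p≢2
  ... | i , p≡1+2i = 1≉0 (begin
    1#                          ≈⟨ sym (+-identityʳ 1#) ⟩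
    1# + 0#                     ≈⟨ +-congˡ (sym (×-zeroʳ i)) ⟩
    1# + i · 0#                 ≈⟨ +-congˡ (×-congʳ i (sym (trans (+-congˡ (+-identityʳ 1#)) 2≈0))) ⟩
    1# + i · (2 · 1#)           ≈⟨ +-congˡ (×-assocˡ 1# i 2) ⟩
    1# + (i ℕ.* 2) · 1#         ≡⟨ ≡.cong (λ k → 1# + k · 1#) (≡.sym (≡.trans (double≡2* i) (ℕP.*-comm 2 i))) ⟩
    suc (double i) · 1#         ≡⟨ ≡.cong (_· 1#) (≡.sym p≡1+2i) ⟩
    p · 1#                      ≈⟨ p×1≈0 ⟩
    0#                          ∎)

module Fields {c ℓ} (R : CommutativeRing c ℓ) (isField : FF.IsField R) where
  open Polynomials R public

  1≉0 : ¬ (1# ≈ 0#)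
  1≉0 = proj₁ isField

  cancel-nonzero : ∀ {a b} → a * b ≈ 0# → ¬ (a ≈ 0#) → b ≈ 0#
  cancel-nonzero {a} {b} ab≈0 a≉0 with proj₂ isField a a≉0
  ... | a⁻¹ , aa⁻¹≈1 = begin
    b               ≈⟨ sym (*-identityˡ b) ⟩
    1# * b          ≈⟨ *-congʳ (sym (trans (*-comm a⁻¹ a) aa⁻¹≈1)) ⟩
    (a⁻¹ * a) * b   ≈⟨ *-assoc a⁻¹ a b ⟩
    a⁻¹ * (a * b)   ≈⟨ *-congˡ ab≈0 ⟩
    a⁻¹ * 0#        ≈⟨ zeroʳ a⁻¹ ⟩
    0#              ∎

  halve-zero : ¬ (1# + 1# ≈ 0#) → ∀ {y} → y + y ≈ 0# → y ≈ 0#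
  halve-zero 2≉0 {y} y+y≈0 = cancel-nonzero (trans (distribʳ y 1# 1#) (trans (+-cong (*-identityˡ y) (*-identityˡ y)) y+y≈0)) 2≉0

  inverse-fixed : ∀ {a b} K → a ^ K ≈ a → a * b ≈ 1# → b ^ K ≈ b
  inverse-fixed {a} {b} K aᴷ≈a ab≈1 = begin
    b ^ K               ≈⟨ sym (*-identityˡ _) ⟩
    1# * b ^ K          ≈⟨ *-congʳ (sym (trans (*-comm b a) ab≈1)) ⟩
    (b * a) * b ^ K     ≈⟨ *-assoc b a (b ^ K) ⟩
    b * (a * b ^ K)     ≈⟨ *-congˡ (*-congʳ (sym aᴷ≈a)) ⟩
    b * (a ^ K * b ^ K) ≈⟨ *-congˡ (sym (^-distrib-* a b K)) ⟩
    b * (a * b) ^ K     ≈⟨ *-congˡ (trans (^-congˡ K ab≈1) (1^n≈1 K)) ⟩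
    b * 1#              ≈⟨ *-identityʳ b ⟩
    b                   ∎

  root-of-divLin : ∀ P r x → eval P r ≈ 0# → eval P x ≈ 0# → ¬ (x ≈ r) → eval (divLin P r) x ≈ 0#
  root-of-divLin P r x Pr≈0 Px≈0 x≉r = cancel-nonzero factored (x≉r ∘ x∙y⁻¹≈ε⇒x≈y _ _)
    where
      factored : (x + - r) * eval (divLin P r) x ≈ 0#
      factored = begin
        (x + - r) * eval (divLin P r) x              ≈⟨ sym (+-identityʳ _) ⟩
        (x + - r) * eval (divLin P r) x + 0#         ≈⟨ +-congˡ (sym Pr≈0) ⟩
        (x + - r) * eval (divLin P r) x + eval P r   ≈⟨ sym (eval-divLin P r x) ⟩
        eval P x                                     ≈⟨ Px≈0 ⟩
        0#                                           ∎

  root-bound : ∀ d P → MonicDeg P d → ∀ {k} → d ℕ.< k → (root : Fin k → Carrier) →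
               (∀ i → eval P (root i) ≈ 0#) → (∀ i j → root i ≈ root j → i ≡ j) → ⊥
  root-bound zero P (lead , above) {suc k} _ root roots _ = 1≉0 (begin
    1#                      ≈⟨ sym lead ⟩
    coeff P 0               ≈⟨ sym (eval-constant P (root fzero) (λ i → above (suc i) (s≤s z≤n))) ⟩
    eval P (root fzero)     ≈⟨ roots fzero ⟩
    0#                      ∎)
  root-bound (suc d) P monic {suc k} (s≤s d<k) root roots distinct =
    root-bound d (divLin P (root fzero)) (divLin-monic P (root fzero) d monic) d<k (root ∘ fsuc)
      (λ i → root-of-divLin P (root fzero) (root (fsuc i)) (roots fzero) (roots (fsuc i))
               (λ eq → FinP.0≢1+n (≡.sym (distinct (fsuc i) fzero eq))))
      (λ i j eq → FinP.suc-injective (distinct (fsuc i) (fsuc j) eq))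

module FiniteFields {c ℓ} (R : CommutativeRing c ℓ) (isField : FF.IsField R) {N : ℕ} (card : FF.HasCard R N) where
  open Fields R isField public
  open import Algebra.Properties.Semiring.Mult semiring using (×1-homo-*; ×-homo-1) renaming (_×_ to _·_)
  open import Algebra.Properties.CommutativeMonoid.Sum +-commutativeMonoid using (sum; sum-permute; ∑-distrib-+; sum-cong-≋; sum-replicate)
  open Bijection card using (to; injective; strictlySurjective)

  index : Carrier → Fin N
  index y = proj₁ (strictlySurjective y)

  to-index : ∀ y → to (index y) ≈ y
  to-index y = proj₂ (strictlySurjective y)

  _≟_ : ∀ x y → Dec (x ≈ y)
  x ≟ y with index x Fin.≟ index y
  ... | yes eq = yes (trans (sym (to-index x)) (trans (reflexive (≡.cong to eq)) (to-index y)))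
  ... | no neq = no (λ x≈y → neq (injective (trans (to-index x) (trans x≈y (sym (to-index y))))))

  zero-product : ∀ {a b} → a * b ≈ 0# → a ≈ 0# ⊎ b ≈ 0#
  zero-product {a} ab≈0 with a ≟ 0#
  ... | yes a≈0 = inj₁ a≈0
  ... | no a≉0  = inj₂ (cancel-nonzero ab≈0 a≉0)

  ^-zero : ∀ n x → x ^ n ≈ 0# → x ≈ 0#
  ^-zero zero    x 1≈0 = ⊥-elim (1≉0 1≈0)
  ^-zero (suc n) x xxⁿ≈0 with zero-product {x} xxⁿ≈0
  ... | inj₁ x≈0  = x≈0
  ... | inj₂ xⁿ≈0 = ^-zero n x xⁿ≈0

  square-roots : ∀ {x y} → x * x ≈ y * y → x ≈ y ⊎ x ≈ - y
  square-roots {x} {y} x²≈y² with zero-product (trans (difference-of-squares x y) (x≈y⇒x∙y⁻¹≈ε x²≈y²))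
  ... | inj₁ x-y≈0 = inj₁ (x∙y⁻¹≈ε⇒x≈y _ _ x-y≈0)
  ... | inj₂ x+y≈0 = inj₂ (+-inverseˡ-unique _ _ x+y≈0)

  -- Lagrange for the additive group: translation by x permutes the
  -- elements, so Σ z = Σ (x + z) = N·x + Σ z, whence N·x = 0.
  cardinality-annihilates : ∀ x → N · x ≈ 0#
  cardinality-annihilates x = begin
    N · x                      ≈⟨ sym (+-identityʳ _) ⟩
    N · x + 0#                 ≈⟨ +-congˡ (sym (-‿inverseʳ (sum to))) ⟩
    N · x + (sum to + - sum to) ≈⟨ sym (+-assoc _ _ _) ⟩
    (N · x + sum to) + - sum to ≈⟨ +-congʳ (sym translation-invariant) ⟩
    sum to + - sum to          ≈⟨ -‿inverseʳ _ ⟩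
    0#                         ∎
    where
      shift : ∀ a → Fin N → Fin N
      shift a i = index (a + to i)
      shift-back : ∀ a b i → b + a ≈ 0# → shift a (shift b i) ≡ i
      shift-back a b i b+a≈0 = injective (begin
        to (shift a (shift b i)) ≈⟨ to-index _ ⟩
        a + to (shift b i)       ≈⟨ +-congˡ (to-index _) ⟩
        a + (b + to i)           ≈⟨ sym (+-assoc a b (to i)) ⟩
        (a + b) + to i           ≈⟨ +-congʳ (trans (+-comm a b) b+a≈0) ⟩
        0# + to i                ≈⟨ +-identityˡ (to i) ⟩
        to i                     ∎)
      translation : Fin N ↔ Fin N
      translation = mk↔ₛ′ (shift x) (shift (- x))
        (λ i → shift-back x (- x) i (-‿inverseˡ x)) (λ i → shift-back (- x) x i (-‿inverseʳ x))
      translation-invariant : sum to ≈ N · x + sum to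
      translation-invariant = begin
        sum to                          ≈⟨ sum-permute to translation ⟩
        sum (λ i → to (shift x i))      ≈⟨ sum-cong-≋ (λ i → to-index (x + to i)) ⟩
        sum (λ i → x + to i)            ≈⟨ ∑-distrib-+ {N} (λ _ → x) to ⟩
        sum {N} (λ _ → x) + sum to      ≈⟨ +-congʳ (sum-replicate N) ⟩
        N · x + sum to                  ∎

  -- If N = pᴹ then p·1 = 0, as (p·1)ᴹ = N·1 = 0.
  characteristic : ∀ p M → N ≡ p ℕ.^ M → p · 1# ≈ 0#
  characteristic p M N≡pᴹ = ^-zero M (p · 1#) (begin
    (p · 1#) ^ M          ≈⟨ sym (power-of-one M) ⟩
    (p ℕ.^ M) · 1#        ≡⟨ ≡.cong (_· 1#) (≡.sym N≡pᴹ) ⟩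
    N · 1#                ≈⟨ cardinality-annihilates 1# ⟩
    0#                    ∎)
    where
      power-of-one : ∀ M → (p ℕ.^ M) · 1# ≈ (p · 1#) ^ M
      power-of-one zero    = ×-homo-1 1#
      power-of-one (suc M) = trans (×1-homo-* p (p ℕ.^ M)) (*-congˡ (power-of-one M))

module Frobenius {c ℓ} (R : CommutativeRing c ℓ) (isField : FF.IsField R)
                 (q : ℕ) {p k : ℕ} (p-prime : Prime p) (q≡pᵏ : q ≡ p ℕ.^ k)
                 {M : ℕ} (card : FF.HasCard R (q ℕ.^ M)) where
  open FiniteFields R isField card public
  open PrimeCharacteristic R using (frobenius-+)
  open import Algebra.Properties.Semiring.Mult semiring using () renaming (_×_ to _·_)

  p·1≈0 : p · 1# ≈ 0#
  p·1≈0 = characteristic p (k ℕ.* M) (≡.trans (≡.cong (ℕ._^ M) q≡pᵏ) (ℕP.^-*-assoc p k M))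

  p-power-+ : ∀ j x y → (x + y) ^ (p ℕ.^ j) ≈ x ^ (p ℕ.^ j) + y ^ (p ℕ.^ j)
  p-power-+ zero    x y = trans (*-identityʳ _) (sym (+-cong (*-identityʳ x) (*-identityʳ y)))
  p-power-+ (suc j) x y = begin
    (x + y) ^ (p ℕ.* p ℕ.^ j)                    ≈⟨ ^-*-assoc (x + y) p (p ℕ.^ j) ⟩
    ((x + y) ^ p) ^ (p ℕ.^ j)                    ≈⟨ ^-congˡ (p ℕ.^ j) (frobenius-+ p-prime p·1≈0 x y) ⟩
    (x ^ p + y ^ p) ^ (p ℕ.^ j)                  ≈⟨ p-power-+ j (x ^ p) (y ^ p) ⟩
    (x ^ p) ^ (p ℕ.^ j) + (y ^ p) ^ (p ℕ.^ j)    ≈⟨ sym (+-cong (^-*-assoc x p (p ℕ.^ j)) (^-*-assoc y p (p ℕ.^ j))) ⟩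
    x ^ (p ℕ.* p ℕ.^ j) + y ^ (p ℕ.* p ℕ.^ j)    ∎

  φ : Carrier → Carrier
  φ x = x ^ q

  φ-cong : ∀ {x y} → x ≈ y → φ x ≈ φ y
  φ-cong = ^-congˡ q

  φ-+ : ∀ x y → φ (x + y) ≈ φ x + φ y
  φ-+ x y = ≡.subst (λ e → (x + y) ^ e ≈ x ^ e + y ^ e) (≡.sym q≡pᵏ) (p-power-+ k x y)

  φ-* : ∀ x y → φ (x * y) ≈ φ x * φ y
  φ-* x y = ^-distrib-* x y q

  φ-0 : φ 0# ≈ 0#
  φ-0 = 0^n≈0 (≡.subst (0 ℕ.<_) (≡.sym q≡pᵏ) (ℕP.m^n>0 p {{prime⇒nonZero p-prime}} k))

  φ-1 : φ 1# ≈ 1#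
  φ-1 = 1^n≈1 q

  open Image φ φ-cong φ-+ φ-* φ-0 φ-1 public using (φ-neg; coeff-linProduct-map)

  -- φ is injective since F has no nonzero nilpotents.
  φ-injective : ∀ {x y} → φ x ≈ φ y → x ≈ y
  φ-injective {x} {y} φx≈φy = x∙y⁻¹≈ε⇒x≈y _ _ (^-zero q (x + - y) (begin
    φ (x + - y)      ≈⟨ φ-+ x (- y) ⟩
    φ x + φ (- y)    ≈⟨ +-congˡ (φ-neg y) ⟩
    φ x + - φ y      ≈⟨ x≈y⇒x∙y⁻¹≈ε φx≈φy ⟩
    0#               ∎))

  frob : ℕ → Carrier → Carrier
  frob zero    x = x
  frob (suc s) x = φ (frob s x)

  frob-cong : ∀ s {x y} → x ≈ y → frob s x ≈ frob s y
  frob-cong zero    x≈y = x≈y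
  frob-cong (suc s) x≈y = φ-cong (frob-cong s x≈y)

  frob-+ℕ : ∀ a b x → frob (a ℕ.+ b) x ≡ frob a (frob b x)
  frob-+ℕ zero    b x = ≡.refl
  frob-+ℕ (suc a) b x = ≡.cong φ (frob-+ℕ a b x)

  frob-* : ∀ s x y → frob s (x * y) ≈ frob s x * frob s y
  frob-* zero    x y = refl
  frob-* (suc s) x y = trans (φ-cong (frob-* s x y)) (φ-* _ _)

  frob-neg : ∀ s x → frob s (- x) ≈ - frob s x
  frob-neg zero    x = refl
  frob-neg (suc s) x = trans (φ-cong (frob-neg s x)) (φ-neg _)

  frob-0 : ∀ s → frob s 0# ≈ 0#
  frob-0 zero    = refl
  frob-0 (suc s) = trans (φ-cong (frob-0 s)) φ-0

  frob-injective : ∀ s {x y} → frob s x ≈ frob s y → x ≈ y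
  frob-injective zero    eq = eq
  frob-injective (suc s) eq = frob-injective s (φ-injective eq)

  frob≈power : ∀ s x → frob s x ≈ x ^ (q ℕ.^ s)
  frob≈power zero    x = sym (*-identityʳ x)
  frob≈power (suc s) x = begin
    φ (frob s x)                ≈⟨ φ-cong (frob≈power s x) ⟩
    (x ^ (q ℕ.^ s)) ^ q         ≈⟨ sym (^-*-assoc x (q ℕ.^ s) q) ⟩
    x ^ (q ℕ.^ s ℕ.* q)         ≡⟨ ≡.cong (x ^_) (ℕP.*-comm (q ℕ.^ s) q) ⟩
    x ^ (q ℕ.^ suc s)           ∎

  InSub⇒fixed : ∀ s x → InSub (q ℕ.^ s) x → frob s x ≈ x
  InSub⇒fixed s x x∈F = trans (frob≈power s x) x∈F

  fixed⇒InSub : ∀ s x → frob s x ≈ x → InSub (q ℕ.^ s) x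
  fixed⇒InSub s x fixed = trans (sym (frob≈power s x)) fixed

  eval-φ : ∀ P x → Over q P → eval P (φ x) ≈ φ (eval P x)
  eval-φ []      x _      = sym φ-0
  eval-φ (a ∷ P) x P∈F[X] = begin
    a + φ x * eval P (φ x)       ≈⟨ +-cong (sym (P∈F[X] 0)) (*-congˡ (eval-φ P x (P∈F[X] ∘ suc))) ⟩
    φ a + φ x * φ (eval P x)     ≈⟨ +-congˡ (sym (φ-* _ _)) ⟩
    φ a + φ (x * eval P x)       ≈⟨ sym (φ-+ _ _) ⟩
    φ (a + x * eval P x)         ∎

  eval-frob : ∀ s P x → Over q P → eval P (frob s x) ≈ frob s (eval P x)
  eval-frob zero    P x _      = refl
  eval-frob (suc s) P x P∈F[X] = trans (eval-φ P (frob s x) P∈F[X]) (φ-cong (eval-frob s P x P∈F[X]))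

  conjugate-root : ∀ s P x → Over q P → eval P x ≈ 0# → eval P (frob s x) ≈ 0#
  conjugate-root s P x P∈F[X] Px≈0 = trans (eval-frob s P x P∈F[X]) (trans (frob-cong s Px≈0) (frob-0 s))

  sqArg-over-F : ∀ A → Over q A → Over q (sqArg A)
  sqArg-over-F A A∈F[X] j with parity j
  ... | even i = ≡.subst (λ a → a ^ q ≈ a) (≡.sym (coeff-sqArg-even A i)) (A∈F[X] i)
  ... | odd i  = ≡.subst (λ a → a ^ q ≈ a) (≡.sym (coeff-sqArg-odd A i)) φ-0

  evens-over-F : ∀ P → Over q P → Over q (evens P)
  evens-over-F P P∈F[X] i = ≡.subst (λ a → a ^ q ≈ a) (≡.sym (coeff-evens P i)) (P∈F[X] (double i))

  odds-over-F : ∀ P → Over q P → Over q (odds P)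
  odds-over-F P P∈F[X] i = ≡.subst (λ a → a ^ q ≈ a) (≡.sym (coeff-odds P i)) (P∈F[X] (suc (double i)))

  -- If φᵐ fixes β, the polynomial ∏_{i<m} (X − φⁱ β) has coefficients in F_q:
  -- φ maps its list of roots to a rotation of itself.
  conjugates : Carrier → ℕ → List Carrier
  conjugates β m = applyUpTo (λ i → frob i β) m

  conjugate-product-over-F : ∀ β m → frob m β ≈ β → Over q (linProduct (conjugates β m))
  conjugate-product-over-F β zero    _          zero    = φ-1
  conjugate-product-over-F β zero    _          (suc i) = φ-0
  conjugate-product-over-F β (suc m) φᵐ⁺¹β≈β i = begin
    φ (coeff (linProduct (conjugates β (suc m))) i)          ≈⟨ sym (coeff-linProduct-map (conjugates β (suc m)) i) ⟩
    coeff (linProduct (map φ (conjugates β (suc m)))) i      ≡⟨ coeff-of (map-applyUpTo (λ j → frob j β) φ (suc m)) ⟩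
    coeff (linProduct (applyUpTo shifted (suc m))) i         ≡⟨ coeff-of (≡.sym (applyUpTo-∷ʳ shifted m)) ⟩
    coeff (linProduct (applyUpTo shifted m ∷ʳ frob (suc m) β)) i ≈⟨ linProduct-cong last≈β i ⟩
    coeff (linProduct (applyUpTo shifted m ∷ʳ β)) i          ≈⟨ linProduct-rotate β (applyUpTo shifted m) i ⟩
    coeff (linProduct (conjugates β (suc m))) i              ∎
    where
      shifted : ℕ → Carrier
      shifted j = frob (suc j) β
      coeff-of : ∀ {rs ss} → rs ≡ ss → coeff (linProduct rs) i ≡ coeff (linProduct ss) i
      coeff-of = ≡.cong (λ rs → coeff (linProduct rs) i)
      last≈β : Pointwise _≈_ (applyUpTo shifted m ∷ʳ frob (suc m) β) (applyUpTo shifted m ∷ʳ β)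
      last≈β = Pointwise.++⁺ (Pointwise.refl refl) (φᵐ⁺¹β≈β ∷ [])

  module MinimalPolynomial (β : Carrier) (B : Poly) (minimal : IsMinPoly q B β) where
    B∈F[X] : Over q B
    B∈F[X] = proj₁ minimal

    d : ℕ
    d = proj₁ (proj₂ minimal)

    B-monic : MonicDeg B d
    B-monic = proj₁ (proj₂ (proj₂ minimal))

    B-root : eval B β ≈ 0#
    B-root = proj₁ (proj₂ (proj₂ (proj₂ minimal)))

    B-least : ∀ Q e → Over q Q → MonicDeg Q e → eval Q β ≈ 0# → d ℕ.≤ e
    B-least = proj₂ (proj₂ (proj₂ (proj₂ minimal)))

    -- A polynomial over F_q with root β, whose coefficients vanish above k < d,
    -- also vanishes at k: otherwise rescaling it gives a monic one of degree k.
    top-coefficient-vanishes : ∀ P → Over q P → eval P β ≈ 0# → ∀ k → k ℕ.< d →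
                               (∀ i → k ℕ.< i → coeff P i ≈ 0#) → coeff P k ≈ 0#
    top-coefficient-vanishes P P∈F[X] Pβ≈0 k k<d above with coeff P k ≟ 0#
    ... | yes Pₖ≈0 = Pₖ≈0
    ... | no Pₖ≉0 with proj₂ isField (coeff P k) Pₖ≉0
    ...   | y , Pₖy≈1 = ⊥-elim (ℕP.<⇒≱ k<d (B-least (scale y P) k yP∈F[X] yP-monic yPβ≈0))
      where
        yP∈F[X] : Over q (scale y P)
        yP∈F[X] i = begin
          coeff (scale y P) i ^ q   ≈⟨ ^-congˡ q (coeff-scale y P i) ⟩
          (y * coeff P i) ^ q       ≈⟨ ^-distrib-* y (coeff P i) q ⟩
          y ^ q * coeff P i ^ q     ≈⟨ *-cong (inverse-fixed q (P∈F[X] k) Pₖy≈1) (P∈F[X] i) ⟩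
          y * coeff P i             ≈⟨ sym (coeff-scale y P i) ⟩
          coeff (scale y P) i       ∎
        yP-monic : MonicDeg (scale y P) k
        yP-monic = trans (coeff-scale y P k) (trans (*-comm y _) Pₖy≈1)
                 , λ i k<i → trans (coeff-scale y P i) (trans (*-congˡ (above i k<i)) (zeroʳ y))
        yPβ≈0 : eval (scale y P) β ≈ 0#
        yPβ≈0 = trans (eval-scale y P β) (trans (*-congˡ Pβ≈0) (zeroʳ y))

    vanishing : ∀ P → Over q P → eval P β ≈ 0# → (∀ i → d ℕ.≤ i → coeff P i ≈ 0#) → ∀ i → coeff P i ≈ 0#
    vanishing P P∈F[X] Pβ≈0 = downFrom d ℕP.≤-refl
      where
        downFrom : ∀ k → k ℕ.≤ d → (∀ i → k ℕ.≤ i → coeff P i ≈ 0#) → ∀ i → coeff P i ≈ 0#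
        downFrom zero    _   above i = above i z≤n
        downFrom (suc k) k<d above   = downFrom k (ℕP.<⇒≤ k<d) above′
          where
            above′ : ∀ i → k ℕ.≤ i → coeff P i ≈ 0#
            above′ i k≤i with ℕP.m≤n⇒m<n∨m≡n k≤i
            ... | inj₁ k<i    = above i k<i
            ... | inj₂ ≡.refl = top-coefficient-vanishes P P∈F[X] Pβ≈0 k k<d above

    -- If φᵐ fixes β (m > 0), then ∏_{i<m} (X − φⁱ β) shows d ≤ m.
    degree-bound : ∀ m → 0 ℕ.< m → frob m β ≈ β → d ℕ.≤ m
    degree-bound (suc m) _ fixed = B-least Π (suc m) (conjugate-product-over-F β (suc m) fixed) Π-monic Π-root
      where
        Π : Poly
        Π = linProduct (conjugates β (suc m))
        Π-monic : MonicDeg Π (suc m)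
        Π-monic = ≡.subst (MonicDeg Π) (length-applyUpTo (λ i → frob i β) (suc m)) (linProduct-monic (conjugates β (suc m)))
        Π-root : eval Π β ≈ 0#
        Π-root = linProduct-root β (applyUpTo (λ i → frob (suc i) β) m)

    -- If d ≤ m and φ⁰β, …, φᵐ⁻¹β are distinct, every root of B is among them:
    -- otherwise B would have m + 1 > d distinct roots.
    root-is-conjugate : ∀ m → d ℕ.≤ m → (∀ i j → i ℕ.< m → j ℕ.< m → frob i β ≈ frob j β → i ≡ j) →
                        ∀ x → eval B x ≈ 0# → ∃ λ a → a ℕ.< m × x ≈ frob a β
    root-is-conjugate m d≤m distinct x Bx≈0
      with FinP.any? {P = λ (j : Fin m) → x ≈ frob (toℕ j) β} (λ j → x ≟ frob (toℕ j) β)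
    ... | yes (j , x≈φʲβ) = toℕ j , FinP.toℕ<n j , x≈φʲβ
    ... | no none = ⊥-elim (root-bound d B B-monic (s≤s d≤m) root roots injective)
      where
        root : Fin (suc m) → Carrier
        root fzero    = x
        root (fsuc j) = frob (toℕ j) β
        roots : ∀ i → eval B (root i) ≈ 0#
        roots fzero    = Bx≈0
        roots (fsuc j) = conjugate-root (toℕ j) B β B∈F[X] B-root
        injective : ∀ i j → root i ≈ root j → i ≡ j
        injective fzero    fzero    _  = ≡.refl
        injective fzero    (fsuc j) eq = ⊥-elim (none (j , eq))
        injective (fsuc i) fzero    eq = ⊥-elim (none (i , sym eq))
        injective (fsuc i) (fsuc j) eq =
          ≡.cong fsuc (FinP.toℕ-injective (distinct (toℕ i) (toℕ j) (FinP.toℕ<n i) (FinP.toℕ<n j) eq))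

  module ProperElement (m : ℕ) {{m≢0 : ℕ.NonZero m}} (β : Carrier) (proper : Proper q m β) where
    Fixes : ℕ → Set ℓ
    Fixes s = frob s β ≈ β

    fixes-m : Fixes m
    fixes-m = InSub⇒fixed m β (proj₁ proper)

    fixes-+ : ∀ a b → Fixes a → Fixes b → Fixes (a ℕ.+ b)
    fixes-+ a b fixes-a fixes-b = ≡.subst (_≈ β) (≡.sym (frob-+ℕ a b β)) (trans (frob-cong a fixes-b) fixes-a)

    fixes-∸ : ∀ a b → Fixes (a ℕ.+ b) → Fixes b → Fixes a
    fixes-∸ a b fixes-a+b fixes-b = trans (frob-cong a (sym fixes-b)) (≡.subst (_≈ β) (frob-+ℕ a b β) fixes-a+b)

    fixes-* : ∀ k a → Fixes a → Fixes (k ℕ.* a)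
    fixes-* zero    a _       = refl
    fixes-* (suc k) a fixes-a = fixes-+ a (k ℕ.* a) fixes-a (fixes-* k a fixes-a)

    -- Bézout: gcd a b = x·a − y·b or y·b − x·a.
    fixes-gcd : ∀ a b → Fixes a → Fixes b → Fixes (gcd a b)
    fixes-gcd a b fixes-a fixes-b with Bézout.identity (gcd-GCD a b)
    ... | Bézout.Identity.+- x y eq = fixes-∸ (gcd a b) (y ℕ.* b) (≡.subst Fixes (≡.sym eq) (fixes-* x a fixes-a)) (fixes-* y b fixes-b)
    ... | Bézout.Identity.-+ x y eq = fixes-∸ (gcd a b) (x ℕ.* a) (≡.subst Fixes (≡.sym eq) (fixes-* y b fixes-b)) (fixes-* x a fixes-a)

    -- gcd s m fixes β and divides m; properness forces gcd s m = m.
    period-divides : ∀ s → Fixes s → m ∣ s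
    period-divides s fixes-s with gcd s m ℕ.<? m
    ... | yes g<m = ⊥-elim (proj₂ proper (gcd s m) (gcd[m,n]∣n s m) g<m
                      (fixed⇒InSub (gcd s m) β (fixes-gcd s m fixes-s fixes-m)))
    ... | no g≮m  = ≡.subst (_∣ s) (ℕP.≤-antisym (∣⇒≤ (gcd[m,n]∣n s m)) (ℕP.≮⇒≥ g≮m)) (gcd[m,n]∣m s m)

    no-smaller-period : ∀ s → 0 ℕ.< s → s ℕ.< m → ¬ Fixes s
    no-smaller-period (suc s) _ s<m fixes-s = ℕP.<⇒≱ s<m (∣⇒≤ (period-divides (suc s) fixes-s))

    -- φⁱβ = φʲβ with i < j < m would make φʲ⁻ⁱ fix β.
    conjugate-collision : ∀ {i j} → i ℕ.< j → j ℕ.< m → ¬ (frob i β ≈ frob j β)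
    conjugate-collision {i} {j} i<j j<m φⁱβ≈φʲβ =
      no-smaller-period (j ℕ.∸ i) (ℕP.m<n⇒0<n∸m i<j) (ℕP.≤-<-trans (ℕP.m∸n≤m j i) j<m)
        (sym (frob-injective i (trans φⁱβ≈φʲβ φʲβ≈φⁱφʲ⁻ⁱβ)))
      where
        φʲβ≈φⁱφʲ⁻ⁱβ : frob j β ≈ frob i (frob (j ℕ.∸ i) β)
        φʲβ≈φⁱφʲ⁻ⁱβ = reflexive (≡.trans (≡.cong (λ e → frob e β) (≡.sym (ℕP.m+[n∸m]≡n (ℕP.<⇒≤ i<j))))
                                        (frob-+ℕ i (j ℕ.∸ i) β))

    conjugates-distinct : ∀ i j → i ℕ.< m → j ℕ.< m → frob i β ≈ frob j β → i ≡ j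
    conjugates-distinct i j i<m j<m eq with ℕP.<-cmp i j
    ... | tri< i<j _ _ = ⊥-elim (conjugate-collision i<j j<m eq)
    ... | tri≈ _ i≡j _ = i≡j
    ... | tri> _ _ j<i = ⊥-elim (conjugate-collision j<i i<m (sym eq))

module SquareCriterion {c ℓ} (R : CommutativeRing c ℓ) (q n : ℕ) (odd-q : OddPrimePower q) (1≤n : 1 ℕ.≤ n)
                       (isField : FF.IsField R) (card : FF.HasCard R (q ℕ.^ (2 ℕ.* n)))
                       (β : CommutativeRing.Carrier R) (proper : FF.Proper R q (2 ℕ.* n) β)
                       (B : FF.Poly R) (minimal : FF.IsMinPoly R q B β) where
  p : ℕ
  p = proj₁ odd-q

  k : ℕ
  k = proj₁ (proj₂ odd-q)

  p-prime : Prime p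
  p-prime = proj₁ (proj₂ (proj₂ odd-q))

  p≢2 : ¬ (p ≡ 2)
  p≢2 = proj₁ (proj₂ (proj₂ (proj₂ odd-q)))

  q≡pᵏ : q ≡ p ℕ.^ k
  q≡pᵏ = proj₂ (proj₂ (proj₂ (proj₂ (proj₂ odd-q))))

  n<2n : n ℕ.< 2 ℕ.* n
  n<2n = ℕP.m<m+n n (ℕP.<-≤-trans 1≤n (ℕP.m≤m+n n 0))

  instance
    2n≢0 : ℕ.NonZero (2 ℕ.* n)
    2n≢0 = ℕ.>-nonZero (ℕP.≤-<-trans z≤n n<2n)

  open Frobenius R isField q {p} {k} p-prime q≡pᵏ {2 ℕ.* n} card
  open MinimalPolynomial β B minimal
  open ProperElement (2 ℕ.* n) β proper
  open PrimeCharacteristic R using (two≉0)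

  2≉0 : ¬ (1# + 1# ≈ 0#)
  2≉0 = two≉0 p-prime p≢2 p·1≈0 1≉0

  β≉0 : ¬ (β ≈ 0#)
  β≉0 β≈0 = no-smaller-period 1 (s≤s z≤n) (ℕP.<-≤-trans (s≤s 1≤n) n<2n) (trans (φ-cong β≈0) (trans φ-0 (sym β≈0)))

  -β≉β : ¬ (- β ≈ β)
  -β≉β -β≈β = β≉0 (halve-zero 2≉0 (trans (+-congˡ (sym -β≈β)) (-‿inverseʳ β)))

  -- β² ∈ F_{qⁿ} iff φⁿβ = −β: φⁿβ is a square root of φⁿ(β²) and φⁿβ ≠ β.
  square-in-subfield⇒ : InSub (q ℕ.^ n) (β * β) → frob n β ≈ - β
  square-in-subfield⇒ β²∈F with square-roots (trans (sym (frob-* n β β)) (InSub⇒fixed n (β * β) β²∈F))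
  ... | inj₁ φⁿβ≈β  = ⊥-elim (no-smaller-period n 1≤n n<2n φⁿβ≈β)
  ... | inj₂ φⁿβ≈-β = φⁿβ≈-β

  square-in-subfield⇐ : frob n β ≈ - β → InSub (q ℕ.^ n) (β * β)
  square-in-subfield⇐ φⁿβ≈-β = fixed⇒InSub n (β * β) (begin
    frob n (β * β)          ≈⟨ frob-* n β β ⟩
    frob n β * frob n β     ≈⟨ *-cong φⁿβ≈-β φⁿβ≈-β ⟩
    - β * - β               ≈⟨ -neg-squared β ⟩
    β * β                   ∎)

  positive-exponent : ∀ a → - β ≈ frob a β → 0 ℕ.< a
  positive-exponent zero    -β≈β = ⊥-elim (-β≉β -β≈β)
  positive-exponent (suc a) _    = s≤s z≤n

  -- If −β is a root of B it is a conjugate φᵃβ with 0 < a < 2n; then φ²ᵃ fixes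
  -- β, so 2n ∣ 2a and a = n.
  minus-root⇒φⁿβ≈-β : eval B (- β) ≈ 0# → frob n β ≈ - β
  minus-root⇒φⁿβ≈-β B[-β]≈0
    with root-is-conjugate (2 ℕ.* n) (degree-bound (2 ℕ.* n) (ℕP.≤-<-trans z≤n n<2n) fixes-m)
                           conjugates-distinct (- β) B[-β]≈0
  ... | a , a<2n , -β≈φᵃβ = ≡.subst (λ e → frob e β ≈ - β) a≡n (sym -β≈φᵃβ)
    where
      fixes-2a : Fixes (2 ℕ.* a)
      fixes-2a = begin
        frob (2 ℕ.* a) β          ≡⟨ ≡.cong (λ e → frob (a ℕ.+ e) β) (ℕP.+-identityʳ a) ⟩
        frob (a ℕ.+ a) β          ≡⟨ frob-+ℕ a a β ⟩
        frob a (frob a β)         ≈⟨ frob-cong a (sym -β≈φᵃβ) ⟩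
        frob a (- β)              ≈⟨ frob-neg a β ⟩
        - frob a β                ≈⟨ -‿cong (sym -β≈φᵃβ) ⟩
        - - β                     ≈⟨ -‿involutive β ⟩
        β                         ∎
      a≡n : a ≡ n
      a≡n = half-of-period (positive-exponent a -β≈φᵃβ) a<2n (period-divides (2 ℕ.* a) fixes-2a)

  -- If −β is a root of B, then the odd part O satisfies O(β²) = 0, as
  -- B(±β) = E(β²) ± β·O(β²); so O(X²) has root β and degree < d, hence is 0.
  minus-root⇒even : eval B (- β) ≈ 0# → B ≈ₚ sqArg (evens B)
  minus-root⇒even B[-β]≈0 = ≈ₚ-sqArg B (evens B) (λ i → reflexive (≡.sym (coeff-evens B i))) odd-coeffs-vanish
    where
      E O : Carrier
      E = eval (evens B) (β * β)
      O = eval (odds B) (β * β)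
      E+βO≈0 : E + β * O ≈ 0#
      E+βO≈0 = trans (sym (eval-even-odd B β)) B-root
      E-βO≈0 : E + - (β * O) ≈ 0#
      E-βO≈0 = begin
        E + - (β * O)                                                  ≈⟨ +-congˡ (-‿distribˡ-* β O) ⟩
        E + - β * O                                                    ≈⟨ sym (+-cong (eval-congʳ (evens B) (-neg-squared β))
                                                                                      (*-congˡ (eval-congʳ (odds B) (-neg-squared β)))) ⟩
        eval (evens B) (- β * - β) + - β * eval (odds B) (- β * - β)  ≈⟨ sym (eval-even-odd B (- β)) ⟩
        eval B (- β)                                                   ≈⟨ B[-β]≈0 ⟩
        0#                                                             ∎
      βO≈0 : β * O ≈ 0#
      βO≈0 = halve-zero 2≉0 (trans (+-congʳ (sym (x∙y⁻¹≈ε⇒x≈y _ _ E-βO≈0))) E+βO≈0)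
      O[X²] : Poly
      O[X²] = sqArg (odds B)
      O[X²]-high : ∀ j → d ℕ.≤ j → coeff O[X²] j ≈ 0#
      O[X²]-high j d≤j with parity j
      ... | even i = trans (reflexive (≡.trans (coeff-sqArg-even (odds B) i) (coeff-odds B i)))
                           (proj₂ B-monic (suc (double i)) (s≤s d≤j))
      ... | odd i  = reflexive (coeff-sqArg-odd (odds B) i)
      O[X²]≈0 : ∀ j → coeff O[X²] j ≈ 0#
      O[X²]≈0 = vanishing O[X²] (sqArg-over-F (odds B) (odds-over-F B B∈F[X]))
                  (trans (eval-sqArg (odds B) β) (cancel-nonzero βO≈0 β≉0)) O[X²]-high
      odd-coeffs-vanish : ∀ i → coeff B (suc (double i)) ≈ 0#
      odd-coeffs-vanish i = trans (reflexive (≡.sym (≡.trans (coeff-sqArg-even (odds B) i) (coeff-odds B i)))) (O[X²]≈0 (double i))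

  -- Conversely an even polynomial B = A(X²) takes the same value at −β as at β.
  even⇒minus-root : ∀ A → B ≈ₚ sqArg A → eval B (- β) ≈ 0#
  even⇒minus-root A B≈A[X²] = begin
    eval B (- β)          ≈⟨ eval-congˡ B (sqArg A) (- β) B≈A[X²] ⟩
    eval (sqArg A) (- β)  ≈⟨ eval-sqArg-neg A β ⟩
    eval (sqArg A) β      ≈⟨ sym (eval-congˡ B (sqArg A) β B≈A[X²]) ⟩
    eval B β              ≈⟨ B-root ⟩
    0#                    ∎

  -- If B = A(X²) with A over F_q then d = 2e, A is monic of degree e with root
  -- β², and any Q over F_q with root β² gives Q(X²) with root β, so e ≤ deg Q.
  even⇒minimal : ∀ A → Over q A → B ≈ₚ sqArg A → IsMinPoly q A (β * β)
  even⇒minimal A A∈F[X] B≈A[X²] with parity d | B-monic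
  ... | odd e  | (lead , _) = ⊥-elim (1≉0 (trans (sym lead) (trans (B≈A[X²] (suc (double e))) (reflexive (coeff-sqArg-odd A e)))))
  ... | even e | (lead , above) = A∈F[X] , e , A-monic , A-root , A-least
    where
      A≈B : ∀ i → coeff A i ≈ coeff B (double i)
      A≈B i = trans (reflexive (≡.sym (coeff-sqArg-even A i))) (sym (B≈A[X²] (double i)))
      A-monic : MonicDeg A e
      A-monic = trans (A≈B e) lead , λ i e<i → trans (A≈B i) (above (double i) (double-<-mono e<i))
      A-root : eval A (β * β) ≈ 0#
      A-root = trans (sym (eval-sqArg A β)) (trans (sym (eval-congˡ B (sqArg A) β B≈A[X²])) B-root)
      A-least : ∀ Q e′ → Over q Q → MonicDeg Q e′ → eval Q (β * β) ≈ 0# → e ℕ.≤ e′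
      A-least Q e′ Q∈F[X] Q-monic Qβ²≈0 = double-≤-cancel
        (B-least (sqArg Q) (double e′) (sqArg-over-F Q Q∈F[X]) (sqArg-monic Q e′ Q-monic) (trans (eval-sqArg Q β) Qβ²≈0))

  square⇒even : InSub (q ℕ.^ n) (β * β) → ∃[ A ] (Over q A × (B ≈ₚ sqArg A))
  square⇒even β²∈F = evens B , evens-over-F B B∈F[X] ,
    minus-root⇒even (trans (eval-congʳ B (sym (square-in-subfield⇒ β²∈F))) (conjugate-root n B β B∈F[X] B-root))
  even⇒square : ∃[ A ] (Over q A × (B ≈ₚ sqArg A)) → InSub (q ℕ.^ n) (β * β)
  even⇒square (A , _ , B≈A[X²]) = square-in-subfield⇐ (minus-root⇒φⁿβ≈-β (even⇒minus-root A B≈A[X²]))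

corollary1 : ∀ {c ℓ : Level} (q n : ℕ) (R : CommutativeRing c ℓ) →
    let open FF R in
    OddPrimePower q → 1 ℕ.≤ n → IsField → HasCard (q ℕ.^ (2 ℕ.* n)) →
    ∀ (β : Carrier) → Proper q (2 ℕ.* n) β →
    ∀ (B : Poly) → IsMinPoly q B β →
    ((InSub (q ℕ.^ n) (β * β) ⇔ (∃[ A ] (Over q A × (B ≈ₚ sqArg A)))) ×
    (∀ (A : Poly) → Over q A → B ≈ₚ sqArg A → IsMinPoly q A (β * β)))
corollary1 q n R odd-q 1≤n isField card β proper B minimal =
  mk⇔ square⇒even even⇒square , even⇒minimal
  where open SquareCriterion R q n odd-q 1≤n isField card β proper B minimal
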